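{- For all $0\le l\le r\le n$ (with indices in range), $R_{lr}\le R_{l(r+1)}$ and $R_{lr}\le R_{(l-1)r}$; that is, extending a subpath cannot decrease its $R_{lr}$ value.
   Context: $P$ is a path with vertices at coordinates $x_0<\dots<x_n$; $\tau>0$; $k\ge1$ fixed. Vertex $x_i$ has weight interval $[w_i^-,w_i^+]$, $0<w_i^-\le w_i^+$; a scenario $s$ assigns $w_i(s)\in[w_i^-,w_i^+]$, $\mathcal S$ the set of scenarios. For a subpath $Q=\{x_l,\dots,x_r\}$ and sink $y=x_t\in Q$: $\Theta_L(Q,y,s)=\max_{l\le i<t}\{(x_t-x_i)\tau+\sum_{j=l}^i w_j(s)\}$, $\Theta_R(Q,y,s)=\max_{t<i\le r}\{(x_i-x_t)\tau+\sum_{j=i}^r w_j(s)\}$ (empty maxima $0$), $\Theta^1(Q,y,s)=\max(\Theta_L,\Theta_R)$. A $k$-partition with sinks: consecutive subpaths $P_1,\dots,P_k$ partitioning the vertices with sinks $y_i\in P_i$; $\Theta^k=\max_i\Theta^1(P_i,y_i,s)$ and $\Theta^k_{\rm opt}(P,s)$ is its minimum over all $k$-partitions with sinks; regret $=\Theta^k-\Theta^k_{\rm opt}$; a worst-case scenario maximizes regret over $\mathcal S$; the dominant part is $P_d$ with $d$ the smallest index maximizing $\Theta^1(P_i,y_i,s)$. A sub-scenario on $\{x_l,\dots,x_r\}$ is left-dominant (resp. right-dominant) if for some $l\le i\le r$, $w_j=w_j^+$ (resp. $w_j^-$) for $l\le j<i$ and $w_j=w_j^-$ (resp. $w_j^+$)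 for $i\le j\le r$. $\mathcal S^*$ is the set of all scenarios that, for some $k$-partition with sinks, are worst-case scenarios for it with dominant part $P_d$ such that $w_i=w_i^-$ off $P_d$ and the sub-scenario in $P_d$ is left- or right-dominant. For the subpath $Q_{lr}=\{x_l,\dots,x_r\}$ define $R_{lr}(s,x_t)=\Theta^1(Q_{lr},x_t,s)-\Theta^k_{\rm opt}(P,s)$, $R_{lr}(x_t)=\max_{s\in\mathcal S^*}R_{lr}(s,x_t)$, and $R_{lr}=\min_{l\le t\le r}R_{lr}(x_t)$.
   Formalization: The coordinates $x_i$, the parameter τ, the weight bounds $w_i^-$, $w_i^+$ and the scenario weights $w_i(s)$ are all rational. -}

module Defs where

open import Data.Nat as ℕ using (ℕ; zero; suc; _∸_)
open import Data.Rational using (ℚ; 0ℚ; _+_; _-_; _*_; _⊔_; _≤_; _<_)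
open import Data.Product using (Σ; ∃; ∃-syntax; _×_; _,_)
open import Data.Sum using (_⊎_)
open import Relation.Binary.PropositionalEquality using (_≡_)

-- A problem instance: path with vertices x 0 < ... < x n (indices 0..n),
-- rate τ > 0, number of sinks k ≥ 1, weight intervals [wm i, wp i].
-- Data is given as functions on ℕ; only indices 0..n are used.
record Instance : Set where
  field
    n     : ℕ
    k     : ℕ
    k≥1   : 1 ℕ.≤ k
    x     : ℕ → ℚ
    x-inc : ∀ i → i ℕ.< n → x i < x (suc i)
    τ     : ℚ
    τ>0   : 0ℚ < τ
    wm    : ℕ → ℚ
    wp    : ℕ → ℚ
    wm>0  : ∀ i → i ℕ.≤ n → 0ℚ < wm i
    wm≤wp : ∀ i → i ℕ.≤ n → wm i ≤ wp i

bigMax : (ℕ → ℚ) → ℕ → ℕ → ℚ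
bigMax f a zero    = 0ℚ
bigMax f a (suc m) = f a ⊔ bigMax f (suc a) m

bigSum : (ℕ → ℚ) → ℕ → ℕ → ℚ
bigSum f a zero    = 0ℚ
bigSum f a (suc m) = f a + bigSum f (suc a) m

Scenario : Set
Scenario = ℕ → ℚ

module _ (I : Instance) where
  open Instance I

  InS : Scenario → Set
  InS s = ∀ i → i ℕ.≤ n → (wm i ≤ s i) × (s i ≤ wp i)

  sumW : Scenario → ℕ → ℕ → ℚ
  sumW s a b = bigSum s a (suc b ∸ a)

  -- Θ_L(Q,y,s) for Q = {x_l..x_r}, y = x_t
  ΘL : ℕ → ℕ → ℕ → Scenario → ℚ
  ΘL l r t s = bigMax (λ i → ((x t - x i) * τ) + sumW s l i) l (t ∸ l)

  ΘR : ℕ → ℕ → ℕ → Scenario → ℚ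
  ΘR l r t s = bigMax (λ i → ((x i - x t) * τ) + sumW s i r) (suc t) (r ∸ t)

  Θ1 : ℕ → ℕ → ℕ → Scenario → ℚ
  Θ1 l r t s = ΘL l r t s ⊔ ΘR l r t s

  -- A k-partition with sinks: part i (0 ≤ i < k) is {x_(lft i) .. x_(rgt i)}
  -- with sink x_(snk i).
  record Partition : Set where
    constructor part
    field
      lft : ℕ → ℕ
      rgt : ℕ → ℕ
      snk : ℕ → ℕ

  ValidPartition : Partition → Set
  ValidPartition (part lft rgt snk) =
    (lft 0 ≡ 0) × (rgt (k ∸ 1) ≡ n)
    × (∀ i → suc i ℕ.< k → lft (suc i) ≡ suc (rgt i))
    × (∀ i → i ℕ.< k → (lft i ℕ.≤ snk i) × (snk i ℕ.≤ rgt i))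

  Θpart : Partition → ℕ → Scenario → ℚ
  Θpart (part lft rgt snk) i s = Θ1 (lft i) (rgt i) (snk i) s

  Θk : Partition → Scenario → ℚ
  Θk Π s = bigMax (λ i → Θpart Π i s) 0 k

  IsOpt : Scenario → ℚ → Set
  IsOpt s v = (∃[ Π ] (ValidPartition Π × Θk Π s ≡ v))
            × (∀ Π → ValidPartition Π → v ≤ Θk Π s)

  WorstCase : Partition → Scenario → Set
  WorstCase Π s = InS s × ∃[ v ] (IsOpt s v ×
    (∀ s' v' → InS s' → IsOpt s' v' → (Θk Π s' - v') ≤ (Θk Π s - v)))

  IsDominant : Partition → Scenario → ℕ → Set
  IsDominant Π s d = (d ℕ.< k)
    × (∀ j → j ℕ.< k → Θpart Π j s ≤ Θpart Π d s)
    × (∀ j → j ℕ.< d → Θpart Π j s < Θpart Π d s)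

  LeftDominant : ℕ → ℕ → Scenario → Set
  LeftDominant a b s = ∃[ i ] ((a ℕ.≤ i) × (i ℕ.≤ b)
    × (∀ j → a ℕ.≤ j → j ℕ.< i → s j ≡ wp j)
    × (∀ j → i ℕ.≤ j → j ℕ.≤ b → s j ≡ wm j))

  RightDominant : ℕ → ℕ → Scenario → Set
  RightDominant a b s = ∃[ i ] ((a ℕ.≤ i) × (i ℕ.≤ b)
    × (∀ j → a ℕ.≤ j → j ℕ.< i → s j ≡ wm j)
    × (∀ j → i ℕ.≤ j → j ℕ.≤ b → s j ≡ wp j))

  InSstar : Scenario → Set
  InSstar s = ∃[ Π ] (ValidPartition Π × WorstCase Π s × ∃[ d ] (IsDominant Π s d
    × (∀ i → i ℕ.≤ n → (i ℕ.< Partition.lft Π d ⊎ Partition.rgt Π d ℕ.< i) → s i ≡ wm i)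
    × (LeftDominant (Partition.lft Π d) (Partition.rgt Π d) s
       ⊎ RightDominant (Partition.lft Π d) (Partition.rgt Π d) s)))

  IsRt : ℕ → ℕ → ℕ → ℚ → Set
  IsRt l r t m =
    (∃[ s ] ∃[ v ] (InSstar s × IsOpt s v × (Θ1 l r t s - v ≡ m)))
    × (∀ s v → InSstar s → IsOpt s v → (Θ1 l r t s - v) ≤ m)

  IsR : ℕ → ℕ → ℚ → Set
  IsR l r ρ = Σ (ℕ → ℚ) λ f → ((∀ t → l ℕ.≤ t → t ℕ.≤ r → IsRt l r t (f t))
    × (∃[ t ] ((l ℕ.≤ t) × (t ℕ.≤ r) × (f t ≡ ρ)))
    × (∀ t → l ℕ.≤ t → t ℕ.≤ r → ρ ≤ f t))

-- Extending Q_lr by one vertex can only increase Θ¹ for a suitably matched sink: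
-- a sink t' of the larger path is either a sink of Q_lr, where only the sum on
-- the extended side grows (weights in 𝒮* are positive), or the new endpoint,
-- which is dominated by the old endpoint since that is strictly closer to every
-- other vertex.  Hence R_lr(x_t) ≤ R(x_t') for the matched sinks, and taking the
-- minimum over t' gives R_lr ≤ R.
module Submission where

open import Defs
open import Data.Nat using (ℕ; suc; _∸_)
open import Data.Rational using (ℚ; 0ℚ; _+_; _-_; _*_; -_)
open import Data.Product using (_×_; ∃-syntax; _,_; proj₁)
open import Data.Sum using (inj₁; inj₂)
import Data.Nat as N
import Data.Nat.Properties as NP
import Data.Rational as Q
open import Data.Rational.Properties
open import Relation.Binary.PropositionalEquality using (_≡_; refl; sym; cong; subst)

bigMax-nonneg : ∀ f a m → 0ℚ Q.≤ bigMax f a m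
bigMax-nonneg f a N.zero    = ≤-refl
bigMax-nonneg f a (suc m) = p≤q⇒p≤r⊔q (f a) (bigMax-nonneg f (suc a) m)

bigMax-mono : ∀ {f g a m m'} → m N.≤ m' → (∀ i → a N.≤ i → i N.< a N.+ m → f i Q.≤ g i)
  → bigMax f a m Q.≤ bigMax g a m'
bigMax-mono {g = g} {a} {m' = m'} N.z≤n f≤g = bigMax-nonneg g a m'
bigMax-mono {a = a} {suc m} (N.s≤s m≤m') f≤g =
  ⊔-mono-≤ (f≤g a NP.≤-refl (NP.m<m+n a N.z<s))
    (bigMax-mono m≤m' λ i a<i i<end → f≤g i (NP.<⇒≤ a<i) (subst (i N.<_) (sym (NP.+-suc a m)) i<end))

bigMax-tail-mono : ∀ {f g a m m'} → m N.< m' → (∀ i → suc a N.≤ i → i N.< suc a N.+ m → f i Q.≤ g i)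
  → bigMax f (suc a) m Q.≤ bigMax g a m'
bigMax-tail-mono {g = g} {a} (N.s≤s m≤m') f≤g = ≤-trans (bigMax-mono m≤m' f≤g) (p≤q⊔p (g a) _)

bigSum-snoc-mono : ∀ f a m → 0ℚ Q.≤ f (a N.+ m) → bigSum f a m Q.≤ bigSum f a (suc m)
bigSum-snoc-mono f a N.zero    0≤f rewrite +-identityʳ (f a) = subst (λ i → 0ℚ Q.≤ f i) (NP.+-identityʳ a) 0≤f
bigSum-snoc-mono f a (suc m) 0≤f =
  +-monoʳ-≤ (f a) (bigSum-snoc-mono f (suc a) m (subst (λ i → 0ℚ Q.≤ f i) (NP.+-suc a m) 0≤f))

module _ (I : Instance) where
  open Instance I

  InSstar⇒nonneg : ∀ {s} → InSstar I s → ∀ {j} → j N.≤ n → 0ℚ Q.≤ s j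
  InSstar⇒nonneg (_ , _ , (s∈𝒮 , _) , _) {j} j≤n = ≤-trans (<⇒≤ (wm>0 j j≤n)) (proj₁ (s∈𝒮 j j≤n))

  sumW-mono-right : ∀ {s i r} → 0ℚ Q.≤ s (suc r) → i N.≤ suc r → sumW I s i r Q.≤ sumW I s i (suc r)
  sumW-mono-right {s} {i} {r} 0≤s i≤r+1 rewrite NP.+-∸-assoc 1 i≤r+1 =
    bigSum-snoc-mono s i (suc r ∸ i) (subst (λ j → 0ℚ Q.≤ s j) (sym (NP.m+[n∸m]≡n i≤r+1)) 0≤s)

  sumW-mono-left : ∀ {s l i} → 0ℚ Q.≤ s l → l N.≤ i → sumW I s (suc l) i Q.≤ sumW I s l i
  sumW-mono-left {s} {l} {i} 0≤s l≤i rewrite NP.+-∸-assoc 1 l≤i =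
    subst (Q._≤ s l + bigSum s (suc l) (i ∸ l)) (+-identityˡ _) (+-monoˡ-≤ _ 0≤s)

  *τ-mono : ∀ {p q} → p Q.≤ q → p * τ Q.≤ q * τ
  *τ-mono = *-monoʳ-≤-nonNeg τ {{Q.nonNegative (<⇒≤ τ>0)}}

  ΘL-at-left-end : ∀ {l r s} → ΘL I l r l s ≡ 0ℚ
  ΘL-at-left-end {l} rewrite NP.n∸n≡0 l = refl

  ΘR-at-right-end : ∀ {l r s} → ΘR I l r r s ≡ 0ℚ
  ΘR-at-right-end {r = r} rewrite NP.n∸n≡0 r = refl

  ΘR-mono-right : ∀ {l r t s} → 0ℚ Q.≤ s (suc r) → t N.≤ r → ΘR I l r t s Q.≤ ΘR I l (suc r) t s
  ΘR-mono-right {r = r} {t} {s} 0≤s t≤r = bigMax-mono (NP.∸-monoˡ-≤ t (NP.n≤1+n r)) λ i _ i<end →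
    +-monoʳ-≤ ((x i - x t) * τ) (sumW-mono-right {s} 0≤s (NP.<⇒≤ (subst (i N.<_) (cong suc (NP.m+[n∸m]≡n t≤r)) i<end)))

  ΘL-mono-left : ∀ {l r t s} → 0ℚ Q.≤ s l → l N.< t → ΘL I (suc l) r t s Q.≤ ΘL I l r t s
  ΘL-mono-left {l} {t = t} {s} 0≤s l<t = bigMax-tail-mono (NP.∸-monoʳ-< (NP.n<1+n l) l<t) λ i l<i _ →
    +-monoʳ-≤ ((x t - x i) * τ) (sumW-mono-left {s} 0≤s (NP.<⇒≤ l<i))

  ΘL-mono-sink-right : ∀ {l r s} → r N.< n → ΘL I l r r s Q.≤ ΘL I l (suc r) (suc r) s
  ΘL-mono-sink-right {l} {r} r<n = bigMax-mono (NP.∸-monoˡ-≤ l (NP.n≤1+n r)) λ i _ _ →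
    +-monoˡ-≤ _ (*τ-mono (+-monoˡ-≤ (- x i) (<⇒≤ (x-inc r r<n))))

  ΘR-mono-sink-left : ∀ {l r s} → l N.< n → l N.< r → ΘR I (suc l) r (suc l) s Q.≤ ΘR I l r l s
  ΘR-mono-sink-left {l} l<n l<r = bigMax-tail-mono (NP.∸-monoʳ-< (NP.n<1+n l) l<r) λ i _ _ →
    +-monoˡ-≤ _ (*τ-mono (+-monoʳ-≤ (x i) (neg-antimono-≤ (<⇒≤ (x-inc l l<n)))))

  Θ1-mono-sink-right : ∀ {l r s} → r N.< n → Θ1 I l r r s Q.≤ Θ1 I l (suc r) (suc r) s
  Θ1-mono-sink-right {l} {r} {s} r<n =
    ⊔-mono-≤ (ΘL-mono-sink-right {l} {r} {s} r<n)
      (≤-trans (≤-reflexive (ΘR-at-right-end {l} {r} {s})) (bigMax-nonneg _ (suc (suc r)) (suc r ∸ suc r)))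

  Θ1-mono-sink-left : ∀ {l r s} → l N.< n → l N.< r → Θ1 I (suc l) r (suc l) s Q.≤ Θ1 I l r l s
  Θ1-mono-sink-left {l} {r} {s} l<n l<r =
    ⊔-mono-≤ (≤-trans (≤-reflexive (ΘL-at-left-end {suc l} {r} {s})) (bigMax-nonneg _ l (l ∸ l)))
      (ΘR-mono-sink-left {l} {r} {s} l<n l<r)

  SinksDominated : ℕ → ℕ → ℕ → ℕ → Set
  SinksDominated l r l' r' = ∀ t' → l' N.≤ t' → t' N.≤ r' →
    ∃[ t ] (l N.≤ t × t N.≤ r × (∀ s → InSstar I s → Θ1 I l r t s Q.≤ Θ1 I l' r' t' s))

  sinksDominated-extend-right : ∀ {l r} → l N.≤ r → r N.< n → SinksDominated l r l (suc r)
  sinksDominated-extend-right {l} {r} l≤r r<n t' l≤t' t'≤r+1 with NP.m≤n⇒m<n∨m≡n t'≤r+1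
  ... | inj₁ (N.s≤s t'≤r) = t' , l≤t' , t'≤r , λ s s∈𝒮* →
    ⊔-monoʳ-≤ (ΘL I l r t' s) (ΘR-mono-right {l} {r} {t'} {s} (InSstar⇒nonneg s∈𝒮* r<n) t'≤r)
  ... | inj₂ refl = r , l≤r , NP.≤-refl , λ s _ → Θ1-mono-sink-right {l} {r} {s} r<n

  sinksDominated-extend-left : ∀ {l r} → l N.< r → r N.≤ n → SinksDominated (suc l) r l r
  sinksDominated-extend-left {l} {r} l<r r≤n t' l≤t' t'≤r with NP.m≤n⇒m<n∨m≡n l≤t'
  ... | inj₁ l<t' = t' , l<t' , t'≤r , λ s s∈𝒮* →
    ⊔-monoˡ-≤ (ΘR I l r t' s) (ΘL-mono-left {l} {r} {t'} {s} (InSstar⇒nonneg s∈𝒮* (NP.<⇒≤ (NP.<-≤-trans l<r r≤n))) l<t')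
  ... | inj₂ refl = suc l , NP.≤-refl , l<r , λ s _ → Θ1-mono-sink-left {l} {r} {s} (NP.<-≤-trans l<r r≤n) l<r

  IsRt-mono : ∀ {l r t l' r' t' a b} → (∀ s → InSstar I s → Θ1 I l r t s Q.≤ Θ1 I l' r' t' s)
    → IsRt I l r t a → IsRt I l' r' t' b → a Q.≤ b
  IsRt-mono Θ≤ ((s , v , s∈𝒮* , opt , refl) , _) (_ , b-max) =
    ≤-trans (+-monoˡ-≤ (- v) (Θ≤ s s∈𝒮*)) (b-max s v s∈𝒮* opt)

  IsR-mono : ∀ {l r l' r' a b} → SinksDominated l r l' r' → IsR I l r a → IsR I l' r' b → a Q.≤ b
  IsR-mono {l} {r} {l'} {r'} dom (f , f-Rt , _ , a≤f) (g , g-Rt , (t' , l'≤t' , t'≤r' , refl) , _)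
    with dom t' l'≤t' t'≤r'
  ... | t , l≤t , t≤r , Θ≤ =
    ≤-trans (a≤f t l≤t t≤r) (IsRt-mono {l} {r} {t} {l'} {r'} {t'} Θ≤ (f-Rt t l≤t t≤r) (g-Rt t' l'≤t' t'≤r'))

lemma3 : (I : Instance) → (l r : ℕ) → l N.≤ r
    → ((r N.< Instance.n I → (a b : ℚ) → IsR I l r a → IsR I l (suc r) b → a Q.≤ b)
    × (1 N.≤ l → r N.≤ Instance.n I → (a b : ℚ) → IsR I l r a → IsR I (l ∸ 1) r b → a Q.≤ b))
lemma3 I l r l≤r =
    (λ r<n _ _ → IsR-mono I (sinksDominated-extend-right I l≤r r<n))
  , λ { (N.s≤s N.z≤n) r≤n _ _ → IsR-mono I (sinksDominated-extend-left I l≤r r≤n) }
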